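{- Let $c,d\geq 1$ be integers. For all integers $b\geq 1$, the list $\{1^2,2^b,3^c,4^d\}$ admits a linear realization.
   Context: The notation $\{1^{a_1},\ldots,t^{a_t}\}$ denotes the multiset with $a_i$ copies of $i$. For a list (multiset) $L$ of positive integers with $|L|$ elements, a linear realization of $L$ is an ordering $[x_0,\ldots,x_{|L|}]$ of $\{0,1,\ldots,|L|\}$ such that the multiset $\{|x_i-x_{i+1}|:0\le i\le |L|-1\}$ equals $L$. -}

module Defs where

open import Data.Nat using (ℕ; suc; ∣_-_∣)
open import Data.List using (List; []; _∷_; length; upTo; replicate; _++_)
open import Data.List.Relation.Binary.Permutation.Propositional using (_↭_)
open import Data.Product using (Σ; _×_)

diffs : List ℕ → List ℕ
diffs []           = []
diffs (x ∷ [])     = []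
diffs (x ∷ y ∷ xs) = ∣ x - y ∣ ∷ diffs (y ∷ xs)

IsLinearRealization : List ℕ → List ℕ → Set
IsLinearRealization L xs = (xs ↭ upTo (suc (length L))) × (diffs xs ↭ L)

HasLinearRealization : List ℕ → Set
HasLinearRealization L = Σ (List ℕ) (IsLinearRealization L)

multiset1234 : ℕ → ℕ → ℕ → ℕ → List ℕ
multiset1234 a b c d =
  replicate a 1 ++ replicate b 2 ++ replicate c 3 ++ replicate d 4

module Submission where

-- Idea: grow small realizations at cuts.  A k-cut of a path on {0, …, n-1} is
-- a gap t | t+1 crossed by exactly the k edges {s+i, s+i+k}, i < k.  Expanding
-- the path there (every vertex above t moves up by k, every crossing edge
-- {x, x+k} becomes the path x, x+k, x+2k) realizes the list enlarged by k
-- copies of k, and every cut of the old path survives, shifted by k if it lies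
-- above t.  So a realization with 2-, 3- and 4-cuts can be grown by any
-- multiples of 2, 3 and 4 copies of 2, 3 and 4.  Writing b = b₀ + 2i,
-- c = c₀ + 3j, d = d₀ + 4l with b₀ ≤ 4, c₀ ≤ 6, d₀ ≤ 8 reduces the theorem to
-- 192 seed realizations; they are tabulated at the end and checked, cuts
-- included, by a certified search that is evaluated during type checking.

open import Defs
open import Data.Bool using (T)
open import Data.Maybe using (Maybe; just; nothing; is-just; to-witness-T; zip; _<∣>_; _>>=_)
import Data.Maybe as Maybe
open import Data.Empty using (⊥)
open import Data.List using (List; []; _∷_; _++_; [_]; map; length; replicate; upTo; applyUpTo; foldr)
open import Data.List.Properties using (++-assoc; ++-identityʳ; length-++; length-replicate; map-++)
open import Data.List.Relation.Unary.All using (All; []; _∷_)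
import Data.List.Relation.Unary.All.Properties as All
open import Data.List.Relation.Binary.Permutation.Propositional
  using (_↭_; ↭-refl; ↭-sym; ↭-trans; ↭-reflexive; ↭-prep; ↭-swap; module PermutationReasoning)
open import Data.List.Relation.Binary.Permutation.Propositional.Properties
  using (++⁺; ++⁺ˡ; ++⁺ʳ; shift; shifts; ++-comm; map⁺; All-resp-↭; ↭-length; ++-commutativeMonoid)
open import Data.Nat using (ℕ; zero; suc; _+_; _*_; _∸_; _≤_; _<_; _≥_; s≤s; s≤s⁻¹; ∣_-_∣; _≤?_; _<?_; _≟_; NonZero)
open import Data.Nat.Properties
open import Data.Nat.DivMod using (_%_; _/_; m≡m%n+[m/n]*n; m%n<n)
open import Data.Fin using (#_)
open import Data.Product using (Σ; _×_; _,_; proj₁; proj₂)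
open import Data.Product.Properties using (≡-dec)
open import Data.Sum using (_⊎_; inj₁; inj₂)
open import Function using (_∘_; id)
open import Relation.Binary.PropositionalEquality using (_≡_; refl; sym; trans; cong; cong₂; subst; module ≡-Reasoning)
open import Relation.Binary.Definitions using (DecidableEquality)
open import Relation.Nullary using (Dec; yes; no; contradiction)
open import Relation.Nullary.Decidable using (from-yes; T?)

interval : ℕ → ℕ → List ℕ
interval a zero    = []
interval a (suc n) = a ∷ interval (suc a) n

applyUpTo-translation : ∀ (f : ℕ → ℕ) a n → (∀ i → f i ≡ a + i) → applyUpTo f n ≡ interval a n
applyUpTo-translation f a zero    _     = refl
applyUpTo-translation f a (suc n) f≗a+_ =
  cong₂ _∷_ (trans (f≗a+ 0) (+-identityʳ a))
            (applyUpTo-translation (f ∘ suc) (suc a) n (λ i → trans (f≗a+ suc i) (+-suc a i)))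

upTo≡interval : ∀ n → upTo n ≡ interval 0 n
upTo≡interval n = applyUpTo-translation id 0 n (λ _ → refl)

interval-++ : ∀ a p q → interval a (p + q) ≡ interval a p ++ interval (a + p) q
interval-++ a zero    q = cong (λ b → interval b q) (sym (+-identityʳ a))
interval-++ a (suc p) q =
  cong (a ∷_) (trans (interval-++ (suc a) p q)
                     (cong (λ b → interval (suc a) p ++ interval b q) (sym (+-suc a p))))

edges : {B : Set} → (ℕ → ℕ → List B) → List ℕ → List B
edges g []           = []
edges g (x ∷ [])     = []
edges g (x ∷ y ∷ xs) = g x y ++ edges g (y ∷ xs)

distance : ℕ → ℕ → List ℕ
distance x y = [ ∣ x - y ∣ ]

diffs≡edges : ∀ P → diffs P ≡ edges distance P
diffs≡edges []           = refl
diffs≡edges (x ∷ [])     = refl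
diffs≡edges (x ∷ y ∷ xs) = cong (∣ x - y ∣ ∷_) (diffs≡edges (y ∷ xs))

module _ {B : Set} where

  edges-split : (g : ℕ → ℕ → List B) (x : ℕ) (zs : List ℕ) (y : ℕ) (ys : List ℕ) →
    edges g (x ∷ zs ++ y ∷ ys) ≡ edges g (x ∷ zs ++ [ y ]) ++ edges g (y ∷ ys)
  edges-split g x []       y ys = cong (_++ edges g (y ∷ ys)) (sym (++-identityʳ (g x y)))
  edges-split g x (z ∷ zs) y ys =
    trans (cong (g x z ++_) (edges-split g z zs y ys)) (sym (++-assoc (g x z) _ _))

  edges-cong : {C : Set} (Q : C → Set) (h : ℕ → ℕ → List C) {g₁ g₂ : ℕ → ℕ → List B} →
    (∀ x y → All Q (h x y) → g₁ x y ≡ g₂ x y) → ∀ P → All Q (edges h P) → edges g₁ P ≡ edges g₂ P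
  edges-cong Q h eq []           _  = refl
  edges-cong Q h eq (x ∷ [])     _  = refl
  edges-cong Q h eq (x ∷ y ∷ ys) qs =
    cong₂ _++_ (eq x y (All.++⁻ˡ (h x y) qs)) (edges-cong Q h eq (y ∷ ys) (All.++⁻ʳ (h x y) qs))

  edges-++ : (g₁ g₂ : ℕ → ℕ → List B) → ∀ P →
    edges (λ x y → g₁ x y ++ g₂ x y) P ↭ edges g₁ P ++ edges g₂ P
  edges-++ g₁ g₂ []           = ↭-refl
  edges-++ g₁ g₂ (x ∷ [])     = ↭-refl
  edges-++ g₁ g₂ (x ∷ y ∷ ys) = begin
    (g₁ x y ++ g₂ x y) ++ edges (λ x y → g₁ x y ++ g₂ x y) (y ∷ ys)
      ≡⟨ ++-assoc (g₁ x y) (g₂ x y) _ ⟩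
    g₁ x y ++ g₂ x y ++ edges (λ x y → g₁ x y ++ g₂ x y) (y ∷ ys)
      ↭⟨ ++⁺ˡ (g₁ x y) (++⁺ˡ (g₂ x y) (edges-++ g₁ g₂ (y ∷ ys))) ⟩
    g₁ x y ++ g₂ x y ++ edges g₁ (y ∷ ys) ++ edges g₂ (y ∷ ys)
      ↭⟨ ++⁺ˡ (g₁ x y) (shifts (g₂ x y) (edges g₁ (y ∷ ys))) ⟩
    g₁ x y ++ edges g₁ (y ∷ ys) ++ g₂ x y ++ edges g₂ (y ∷ ys)
      ≡⟨ ++-assoc (g₁ x y) _ _ ⟨
    (g₁ x y ++ edges g₁ (y ∷ ys)) ++ g₂ x y ++ edges g₂ (y ∷ ys) ∎
    where open PermutationReasoning

  edges-map : {C : Set} (f : C → B) (h : ℕ → ℕ → List C) → ∀ P →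
    edges (λ x y → map f (h x y)) P ≡ map f (edges h P)
  edges-map f h []           = refl
  edges-map f h (x ∷ [])     = refl
  edges-map f h (x ∷ y ∷ ys) =
    trans (cong (map f (h x y) ++_) (edges-map f h (y ∷ ys))) (sym (map-++ f (h x y) _))

-- Crossings.  The edge {x, y} crosses the gap between t and t + 1 when
-- exactly one of its ends is ≤ t; it is then recorded as (lower end, length).

crossing : ℕ → ℕ → ℕ → List (ℕ × ℕ)
crossing t x y with x ≤? t | y ≤? t
... | yes _ | no _  = [ (x , y ∸ x) ]
... | no _  | yes _ = [ (y , x ∸ y) ]
... | _     | _     = []

crossings : ℕ → List ℕ → List (ℕ × ℕ)
crossings t = edges (crossing t)

module _ {t x y : ℕ} where

  crossing-≤≤ : x ≤ t → y ≤ t → crossing t x y ≡ []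
  crossing-≤≤ x≤t y≤t with x ≤? t | y ≤? t
  ... | yes _   | yes _   = refl
  ... | no x≰t  | _       = contradiction x≤t x≰t
  ... | yes _   | no y≰t  = contradiction y≤t y≰t

  crossing->> : t < x → t < y → crossing t x y ≡ []
  crossing->> t<x t<y with x ≤? t | y ≤? t
  ... | no _    | no _    = refl
  ... | yes x≤t | _       = contradiction x≤t (<⇒≱ t<x)
  ... | no _    | yes y≤t = contradiction y≤t (<⇒≱ t<y)

  crossing-≤> : x ≤ t → t < y → crossing t x y ≡ [ (x , y ∸ x) ]
  crossing-≤> x≤t t<y with x ≤? t | y ≤? t
  ... | yes _  | no _    = refl
  ... | no x≰t | _       = contradiction x≤t x≰t
  ... | yes _  | yes y≤t = contradiction y≤t (<⇒≱ t<y)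

  crossing->≤ : t < x → y ≤ t → crossing t x y ≡ [ (y , x ∸ y) ]
  crossing->≤ t<x y≤t with x ≤? t | y ≤? t
  ... | no _    | yes _  = refl
  ... | yes x≤t | _      = contradiction x≤t (<⇒≱ t<x)
  ... | no _    | no y≰t = contradiction y≤t y≰t

translate : ℕ → ℕ × ℕ → ℕ × ℕ
translate M (v , l) = (v + M , l)

+M∸+M : ∀ x y M → (x + M) ∸ (y + M) ≡ x ∸ y
+M∸+M x y M = trans (cong₂ _∸_ (+-comm x M) (+-comm y M)) ([m+n]∸[m+o]≡n∸o M x y)

crossing-translate : ∀ t x y M → crossing (t + M) (x + M) (y + M) ≡ map (translate M) (crossing t x y)
crossing-translate t x y M with x ≤? t | y ≤? t
... | yes x≤t | yes y≤t = crossing-≤≤ (+-monoˡ-≤ M x≤t) (+-monoˡ-≤ M y≤t)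
... | no x≰t  | no y≰t  = crossing->> (+-monoˡ-< M (≰⇒> x≰t)) (+-monoˡ-< M (≰⇒> y≰t))
... | yes x≤t | no y≰t  =
  trans (crossing-≤> (+-monoˡ-≤ M x≤t) (+-monoˡ-< M (≰⇒> y≰t))) (cong (λ l → [ (x + M , l) ]) (+M∸+M y x M))
... | no x≰t  | yes y≤t =
  trans (crossing->≤ (+-monoˡ-< M (≰⇒> x≰t)) (+-monoˡ-≤ M y≤t)) (cong (λ l → [ (y + M , l) ]) (+M∸+M x y M))

spans : ℕ → ℕ → ℕ → List (ℕ × ℕ)
spans s zero    k = []
spans s (suc m) k = (s , k) ∷ spans (suc s) m k

HasLength : ℕ → ℕ × ℕ → Set
HasLength k (_ , l) = l ≡ k

spans-length : ∀ s m k → All (HasLength k) (spans s m k)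
spans-length s zero    k = []
spans-length s (suc m) k = refl ∷ spans-length (suc s) m k

spans-lengths : ∀ s m k → map proj₂ (spans s m k) ≡ replicate m k
spans-lengths s zero    k = refl
spans-lengths s (suc m) k = cong (k ∷_) (spans-lengths (suc s) m k)

spans-translate : ∀ s m k M → map (translate M) (spans s m k) ≡ spans (s + M) m k
spans-translate s zero    k M = refl
spans-translate s (suc m) k M = cong ((s + M , k) ∷_) (spans-translate (suc s) m k M)

spans-upper : ∀ s m k → map (λ p → proj₁ p + k) (spans s m k) ≡ interval (s + k) m
spans-upper s zero    k = refl
spans-upper s (suc m) k = cong (s + k ∷_) (spans-upper (suc s) m k)

record Cut (n k : ℕ) (P : List ℕ) : Set where
  field
    gap      : ℕ
    first    : ℕ
    first+k  : first + k ≡ suc gap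
    gap<n    : gap < n
    crossers : crossings gap P ↭ spans first k k

module Expansion (t k : ℕ) where

  lift : ℕ → ℕ
  lift v with v ≤? t
  ... | yes _ = v
  ... | no _  = v + k

  lift-≤ : ∀ {v} → v ≤ t → lift v ≡ v
  lift-≤ {v} v≤t with v ≤? t
  ... | yes _  = refl
  ... | no v≰t = contradiction v≤t v≰t

  lift-> : ∀ {v} → t < v → lift v ≡ v + k
  lift-> {v} t<v with v ≤? t
  ... | yes v≤t = contradiction v≤t (<⇒≱ t<v)
  ... | no _    = refl

  raise : ℕ × ℕ → ℕ
  raise (v , _) = v + k

  bridge : ℕ → ℕ → List ℕ
  bridge x y = map raise (crossing t x y)

  expand-from : ℕ → List ℕ → List ℕ
  expand-from x []       = []
  expand-from x (y ∷ ys) = bridge x y ++ lift y ∷ expand-from y ys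

  expand : List ℕ → List ℕ
  expand []       = []
  expand (x ∷ xs) = lift x ∷ expand-from x xs

  segment : ℕ → ℕ → List ℕ
  segment x y = lift x ∷ bridge x y ++ [ lift y ]

  edges-expand : {B : Set} (g : ℕ → ℕ → List B) → ∀ P →
    edges g (expand P) ≡ edges (λ x y → edges g (segment x y)) P
  edges-expand g []           = refl
  edges-expand g (x ∷ [])     = refl
  edges-expand g (x ∷ y ∷ ys) =
    trans (edges-split g (lift x) (bridge x y) (lift y) (expand-from y ys))
          (cong (edges g (segment x y) ++_) (edges-expand g (y ∷ ys)))

  expand-from-vertices : ∀ x ys → expand-from x ys ↭ map lift ys ++ edges bridge (x ∷ ys)
  expand-from-vertices x []       = ↭-refl
  expand-from-vertices x (y ∷ ys) = begin
    bridge x y ++ lift y ∷ expand-from y ys     ↭⟨ shift (lift y) (bridge x y) _ ⟩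
    lift y ∷ bridge x y ++ expand-from y ys     ↭⟨ ↭-prep (lift y) (++⁺ˡ (bridge x y) (expand-from-vertices y ys)) ⟩
    lift y ∷ bridge x y ++ map lift ys ++ _     ↭⟨ ↭-prep (lift y) (shifts (bridge x y) (map lift ys)) ⟩
    lift y ∷ map lift ys ++ bridge x y ++ _     ∎
    where open PermutationReasoning

  expand-vertices : ∀ P → expand P ↭ map lift P ++ edges bridge P
  expand-vertices []       = ↭-refl
  expand-vertices (x ∷ xs) = ↭-prep (lift x) (expand-from-vertices x xs)

  data Shape : ℕ → ℕ → Set where
    below : ∀ {x y} → x ≤ t → y ≤ t → Shape x y
    above : ∀ {x y} → t < x → t < y → Shape x y
    up    : ∀ {x} → x ≤ t → t < x + k → Shape x (x + k)
    down  : ∀ {y} → y ≤ t → t < y + k → Shape (y + k) y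

  upper-end : ∀ {a b} → a ≤ t → t < b → b ∸ a ≡ k → b ≡ a + k
  upper-end {a} a≤t t<b b∸a≡k = trans (sym (m+[n∸m]≡n (≤-trans a≤t (<⇒≤ t<b)))) (cong (a +_) b∸a≡k)

  shape : ∀ x y → All (HasLength k) (crossing t x y) → Shape x y
  shape x y short with x ≤? t | y ≤? t | short
  ... | yes x≤t | yes y≤t | _ = below x≤t y≤t
  ... | no x≰t  | no y≰t  | _ = above (≰⇒> x≰t) (≰⇒> y≰t)
  ... | yes x≤t | no y≰t  | y∸x≡k ∷ [] =
    let y≡x+k = upper-end x≤t (≰⇒> y≰t) y∸x≡k
    in subst (Shape x) (sym y≡x+k) (up x≤t (subst (t <_) y≡x+k (≰⇒> y≰t)))
  ... | no x≰t  | yes y≤t | x∸y≡k ∷ [] =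
    let x≡y+k = upper-end y≤t (≰⇒> x≰t) x∸y≡k
    in subst (λ z → Shape z y) (sym x≡y+k) (down y≤t (subst (t <_) x≡y+k (≰⇒> x≰t)))

  segment-as : ∀ {x y a b cs} → lift x ≡ a → crossing t x y ≡ cs → lift y ≡ b →
    segment x y ≡ a ∷ map raise cs ++ [ b ]
  segment-as refl refl refl = refl

  segment-shape : ∀ {x y} → Shape x y → List ℕ
  segment-shape (below {x} {y} _ _) = x ∷ y ∷ []
  segment-shape (above {x} {y} _ _) = x + k ∷ y + k ∷ []
  segment-shape (up {x} _ _)        = x ∷ x + k ∷ x + k + k ∷ []
  segment-shape (down {y} _ _)      = y + k + k ∷ y + k ∷ y ∷ []

  segment≡ : ∀ {x y} (s : Shape x y) → segment x y ≡ segment-shape s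
  segment≡ (below x≤t y≤t) = segment-as (lift-≤ x≤t) (crossing-≤≤ x≤t y≤t) (lift-≤ y≤t)
  segment≡ (above t<x t<y) = segment-as (lift-> t<x) (crossing->> t<x t<y) (lift-> t<y)
  segment≡ (up x≤t t<x+k)  = segment-as (lift-≤ x≤t) (crossing-≤> x≤t t<x+k) (lift-> t<x+k)
  segment≡ (down y≤t t<y+k) = segment-as (lift-> t<y+k) (crossing->≤ t<y+k y≤t) (lift-≤ y≤t)

  segment-distances : ∀ {x y} → Shape x y →
    edges distance (segment x y) ≡ map proj₂ (crossing t x y) ++ distance x y
  segment-distances (below x≤t y≤t) rewrite segment≡ (below x≤t y≤t) | crossing-≤≤ x≤t y≤t = refl
  segment-distances (above {x} {y} t<x t<y) rewrite segment≡ (above t<x t<y) | crossing->> t<x t<y =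
    cong [_] (trans (cong₂ ∣_-_∣ (+-comm x k) (+-comm y k)) (∣m+n-m+o∣≡∣n-o∣ k x y))
  segment-distances (up {x} x≤t t<x+k) rewrite segment≡ (up x≤t t<x+k) | crossing-≤> x≤t t<x+k =
    cong₂ (λ a b → a ∷ b ∷ []) (trans (∣m-m+n∣≡n x k) (sym (m+n∸m≡n x k)))
                               (trans (∣m-m+n∣≡n (x + k) k) (sym (∣m-m+n∣≡n x k)))
  segment-distances (down {y} y≤t t<y+k) rewrite segment≡ (down y≤t t<y+k) | crossing->≤ t<y+k y≤t =
    cong (_∷ ∣ y + k - y ∣ ∷ [])
      (trans (∣-∣-comm (y + k + k) (y + k)) (trans (∣m-m+n∣≡n (y + k) k) (sym (m+n∸m≡n y k))))

  segment-crossings-≤ : ∀ {t' x y} → t' ≤ t → Shape x y →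
    edges (crossing t') (segment x y) ≡ crossing t' x y
  segment-crossings-≤ {t'} t'≤t s = trans (cong (edges (crossing t')) (segment≡ s)) (crossings-≤ s)
    where
    above-t' : ∀ {v} → t < v → t' < v
    above-t' t<v = ≤-<-trans t'≤t t<v
    crossings-≤ : ∀ {x y} (s : Shape x y) → edges (crossing t') (segment-shape s) ≡ crossing t' x y
    crossings-≤ (below _ _) = ++-identityʳ _
    crossings-≤ (above t<x t<y) =
      trans (++-identityʳ _)
        (trans (crossing->> (above-t' (<-≤-trans t<x (m≤m+n _ k))) (above-t' (<-≤-trans t<y (m≤m+n _ k))))
               (sym (crossing->> (above-t' t<x) (above-t' t<y))))
    crossings-≤ (up {x} _ t<x+k) =
      trans (cong (crossing t' x (x + k) ++_)
                  (cong (_++ []) (crossing->> (above-t' t<x+k) (above-t' (<-≤-trans t<x+k (m≤m+n _ k))))))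
            (++-identityʳ _)
    crossings-≤ (down {y} _ t<y+k) =
      trans (cong (_++ crossing t' (y + k) y ++ [])
                  (crossing->> (above-t' (<-≤-trans t<y+k (m≤m+n _ k))) (above-t' t<y+k)))
            (++-identityʳ _)

  segment-crossings-> : ∀ {t' x y} → t < t' → Shape x y →
    edges (crossing (t' + k)) (segment x y) ≡ map (translate k) (crossing t' x y)
  segment-crossings-> {t'} t<t' s = trans (cong (edges (crossing (t' + k))) (segment≡ s)) (crossings-> s)
    where
    ≤t' : ∀ {v} → v ≤ t → v ≤ t'
    ≤t' v≤t = ≤-trans v≤t (<⇒≤ t<t')
    +k≤t'+k : ∀ {v} → v ≤ t → v + k ≤ t' + k
    +k≤t'+k v≤t = +-monoˡ-≤ k (≤t' v≤t)
    ≤t'+k : ∀ {v} → v ≤ t → v ≤ t' + k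
    ≤t'+k v≤t = ≤-trans (m≤m+n _ k) (+k≤t'+k v≤t)
    crossings-> : ∀ {x y} (s : Shape x y) →
      edges (crossing (t' + k)) (segment-shape s) ≡ map (translate k) (crossing t' x y)
    crossings-> (below x≤t y≤t) =
      trans (++-identityʳ _)
        (trans (crossing-≤≤ (≤t'+k x≤t) (≤t'+k y≤t))
               (cong (map (translate k)) (sym (crossing-≤≤ (≤t' x≤t) (≤t' y≤t)))))
    crossings-> (above {x} {y} _ _) = trans (++-identityʳ _) (crossing-translate t' x y k)
    crossings-> (up {x} x≤t _) =
      trans (cong (_++ crossing (t' + k) (x + k) (x + k + k) ++ []) (crossing-≤≤ (≤t'+k x≤t) (+k≤t'+k x≤t)))
            (trans (++-identityʳ _) (crossing-translate t' x (x + k) k))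
    crossings-> (down {y} y≤t _) =
      trans (cong (crossing (t' + k) (y + k + k) (y + k) ++_)
                  (cong (_++ []) (crossing-≤≤ (+k≤t'+k y≤t) (≤t'+k y≤t))))
            (trans (++-identityʳ _) (crossing-translate t' (y + k) y k))

  lift-interval-≤ : ∀ a p → a + p ≤ suc t → map lift (interval a p) ≡ interval a p
  lift-interval-≤ a zero    _     = refl
  lift-interval-≤ a (suc p) a+p≤ =
    cong₂ _∷_ (lift-≤ (s≤s⁻¹ (≤-trans (s≤s (m≤m+n a p)) (≤-trans (≤-reflexive (sym (+-suc a p))) a+p≤))))
              (lift-interval-≤ (suc a) p (≤-trans (≤-reflexive (sym (+-suc a p))) a+p≤))

  lift-interval-> : ∀ a p → t < a → map lift (interval a p) ≡ interval (a + k) p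
  lift-interval-> a zero    _   = refl
  lift-interval-> a (suc p) t<a = cong₂ _∷_ (lift-> t<a) (lift-interval-> (suc a) p (m<n⇒m<1+n t<a))

  module _ {P : List ℕ} (short : All (HasLength k) (crossings t P)) where

    along-edges : {B : Set} {g₁ g₂ : ℕ → ℕ → List B} →
      (∀ {x y} → Shape x y → g₁ x y ≡ g₂ x y) → edges g₁ P ≡ edges g₂ P
    along-edges eq = edges-cong (HasLength k) (crossing t) (λ x y s → eq (shape x y s)) P short

    expand-diffs : diffs (expand P) ↭ map proj₂ (crossings t P) ++ diffs P
    expand-diffs = begin
      diffs (expand P)                                  ≡⟨ diffs≡edges (expand P) ⟩
      edges distance (expand P)                         ≡⟨ edges-expand distance P ⟩
      edges (λ x y → edges distance (segment x y)) P    ≡⟨ along-edges segment-distances ⟩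
      edges (λ x y → map proj₂ (crossing t x y) ++ distance x y) P
                                                        ↭⟨ edges-++ _ distance P ⟩
      edges (λ x y → map proj₂ (crossing t x y)) P ++ edges distance P
                                                        ≡⟨ cong₂ _++_ (edges-map proj₂ (crossing t) P)
                                                                      (sym (diffs≡edges P)) ⟩
      map proj₂ (crossings t P) ++ diffs P              ∎
      where open PermutationReasoning

    expand-crossings-≤ : ∀ {t'} → t' ≤ t → crossings t' (expand P) ≡ crossings t' P
    expand-crossings-≤ t'≤t =
      trans (edges-expand _ P) (along-edges (segment-crossings-≤ t'≤t))

    expand-crossings-> : ∀ {t'} → t < t' → crossings (t' + k) (expand P) ≡ map (translate k) (crossings t' P)
    expand-crossings-> {t'} t<t' =
      trans (edges-expand _ P)
            (trans (along-edges (segment-crossings-> t<t')) (edges-map (translate k) (crossing t') P))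

module ExpandAtCut {n k : ℕ} {P : List ℕ} (c : Cut n k P) where
  open Cut c
  open Expansion gap k public using (expand)
  open Expansion gap k hiding (expand)

  short : All (HasLength k) (crossings gap P)
  short = All-resp-↭ (↭-sym crossers) (spans-length first k k)

  expand-diffs-cut : diffs (expand P) ↭ replicate k k ++ diffs P
  expand-diffs-cut = ↭-trans (expand-diffs short)
    (↭-trans (++⁺ʳ (diffs P) (map⁺ proj₂ crossers)) (↭-reflexive (cong (_++ diffs P) (spans-lengths first k k))))

  bridges : edges bridge P ↭ interval (suc gap) k
  bridges = begin
    edges bridge P              ≡⟨ edges-map raise (crossing gap) P ⟩
    map raise (crossings gap P) ↭⟨ map⁺ raise crossers ⟩
    map raise (spans first k k) ≡⟨ spans-upper first k k ⟩
    interval (first + k) k      ≡⟨ cong (λ a → interval a k) first+k ⟩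
    interval (suc gap) k        ∎
    where open PermutationReasoning

  above-gap : ℕ
  above-gap = n ∸ suc gap

  n≡ : n ≡ suc gap + above-gap
  n≡ = sym (m+[n∸m]≡n gap<n)

  lifted : map lift (upTo n) ≡ interval 0 (suc gap) ++ interval (suc gap + k) above-gap
  lifted = begin
    map lift (upTo n)                                            ≡⟨ cong (map lift) (upTo≡interval n) ⟩
    map lift (interval 0 n)                                      ≡⟨ cong (λ m → map lift (interval 0 m)) n≡ ⟩
    map lift (interval 0 (suc gap + above-gap))                  ≡⟨ cong (map lift) (interval-++ 0 (suc gap) above-gap) ⟩
    map lift (interval 0 (suc gap) ++ interval (suc gap) above-gap) ≡⟨ map-++ lift (interval 0 (suc gap)) _ ⟩
    map lift (interval 0 (suc gap)) ++ map lift (interval (suc gap) above-gap)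
      ≡⟨ cong₂ _++_ (lift-interval-≤ 0 (suc gap) ≤-refl) (lift-interval-> (suc gap) above-gap ≤-refl) ⟩
    interval 0 (suc gap) ++ interval (suc gap + k) above-gap     ∎
    where open ≡-Reasoning

  enlarged : upTo (n + k) ≡ interval 0 (suc gap) ++ interval (suc gap) k ++ interval (suc gap + k) above-gap
  enlarged = begin
    upTo (n + k)                                 ≡⟨ upTo≡interval (n + k) ⟩
    interval 0 (n + k)                           ≡⟨ cong (λ m → interval 0 (m + k)) n≡ ⟩
    interval 0 (suc gap + above-gap + k)         ≡⟨ cong (interval 0) (trans (+-assoc (suc gap) above-gap k)
                                                                             (cong (suc gap +_) (+-comm above-gap k))) ⟩
    interval 0 (suc gap + (k + above-gap))       ≡⟨ interval-++ 0 (suc gap) (k + above-gap) ⟩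
    interval 0 (suc gap) ++ interval (suc gap) (k + above-gap)
                                                 ≡⟨ cong (interval 0 (suc gap) ++_) (interval-++ (suc gap) k above-gap) ⟩
    interval 0 (suc gap) ++ interval (suc gap) k ++ interval (suc gap + k) above-gap ∎
    where open ≡-Reasoning

  expand-vertices-cut : P ↭ upTo n → expand P ↭ upTo (n + k)
  expand-vertices-cut P↭ = begin
    expand P                                     ↭⟨ expand-vertices P ⟩
    map lift P ++ edges bridge P                 ↭⟨ ++⁺ (map⁺ lift P↭) bridges ⟩
    map lift (upTo n) ++ interval (suc gap) k    ≡⟨ cong (_++ interval (suc gap) k) lifted ⟩
    (low ++ high) ++ interval (suc gap) k        ≡⟨ ++-assoc low high _ ⟩
    low ++ high ++ interval (suc gap) k          ↭⟨ ++⁺ˡ low (++-comm high _) ⟩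
    low ++ interval (suc gap) k ++ high          ≡⟨ enlarged ⟨
    upTo (n + k)                                 ∎
    where
    open PermutationReasoning
    low  = interval 0 (suc gap)
    high = interval (suc gap + k) above-gap

  expand-cut : ∀ {k'} → Cut n k' P → Cut (n + k) k' (expand P)
  expand-cut {k'} c' with Cut.gap c' ≤? gap
  ... | yes t'≤t = record
    { gap      = Cut.gap c'
    ; first    = Cut.first c'
    ; first+k  = Cut.first+k c'
    ; gap<n    = ≤-trans (Cut.gap<n c') (m≤m+n n k)
    ; crossers = ↭-trans (↭-reflexive (expand-crossings-≤ {P} short t'≤t)) (Cut.crossers c')
    }
  ... | no t'≰t = record
    { gap      = Cut.gap c' + k
    ; first    = Cut.first c' + k
    ; first+k  = trans (trans (+-assoc (Cut.first c') k k') (trans (cong (Cut.first c' +_) (+-comm k k'))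
                                                                 (sym (+-assoc (Cut.first c') k' k))))
                       (cong (_+ k) (Cut.first+k c'))
    ; gap<n    = +-monoˡ-< k (Cut.gap<n c')
    ; crossers = begin
        crossings (Cut.gap c' + k) (expand P)            ≡⟨ expand-crossings-> {P} short (≰⇒> t'≰t) ⟩
        map (translate k) (crossings (Cut.gap c') P)     ↭⟨ map⁺ (translate k) (Cut.crossers c') ⟩
        map (translate k) (spans (Cut.first c') k' k')   ≡⟨ spans-translate (Cut.first c') k' k' k ⟩
        spans (Cut.first c' + k) k' k'                   ∎
    }
    where open PermutationReasoning

record Growable (L : List ℕ) (W : ℕ → Set) : Set where
  field
    path     : List ℕ
    realizes : IsLinearRealization L path
    cuts     : ∀ {k} → W k → Cut (suc (length L)) k path

open Growable

growable-↭ : ∀ {L L' W} → L ↭ L' → Growable L W → Growable L' W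
growable-↭ {W = W} L↭L' g = record
  { path     = path g
  ; realizes = subst (λ m → path g ↭ upTo (suc m)) length≡ (proj₁ (realizes g)) , ↭-trans (proj₂ (realizes g)) L↭L'
  ; cuts     = λ {k} w → subst (λ m → Cut (suc m) k (path g)) length≡ (cuts g w)
  }
  where length≡ = ↭-length L↭L'

grow : ∀ {L W k} → W k → Growable L W → Growable (replicate k k ++ L) W
grow {L} {W} {k} w g = record
  { path     = expand (path g)
  ; realizes = subst (λ m → expand (path g) ↭ upTo m) n+k≡ (expand-vertices-cut (proj₁ (realizes g)))
             , ↭-trans expand-diffs-cut (++⁺ˡ (replicate k k) (proj₂ (realizes g)))
  ; cuts     = λ {k'} w' → subst (λ m → Cut m k' (expand (path g))) n+k≡ (expand-cut (cuts g w'))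
  }
  where
  open ExpandAtCut (cuts g w)
  n+k≡ : suc (length L) + k ≡ suc (length (replicate k k ++ L))
  n+k≡ = cong suc (trans (+-comm (length L) k)
                          (sym (trans (length-++ (replicate k k)) (cong (_+ length L) (length-replicate k)))))

replicate-+ : ∀ {A : Set} m n (x : A) → replicate (m + n) x ≡ replicate m x ++ replicate n x
replicate-+ zero    n x = refl
replicate-+ (suc m) n x = cong (x ∷_) (replicate-+ m n x)

grow-by : ∀ {L W} k m → m ≡ 0 ⊎ W k → Growable L W → Growable (replicate (m * k) k ++ L) W
grow-by k zero     _          g = g
grow-by {L} k (suc m) (inj₂ w) g =
  subst (λ R → Growable R _) (sym (trans (cong (_++ L) (replicate-+ k (m * k) k)) (++-assoc (replicate k k) _ L)))
        (grow w (grow-by k m (inj₂ w) g))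

module PermutationCheck {A : Set} (_≟ᴬ_ : DecidableEquality A) where

  extract : (x : A) (ys : List A) → Maybe (Σ (List A) λ zs → ys ↭ x ∷ zs)
  extract x []       = nothing
  extract x (y ∷ ys) with x ≟ᴬ y
  ... | yes refl = just (ys , ↭-refl)
  ... | no _     = Maybe.map (λ (zs , ys↭) → y ∷ zs , ↭-trans (↭-prep y ys↭) (↭-swap y x ↭-refl)) (extract x ys)

  _↭?_ : (xs ys : List A) → Maybe (xs ↭ ys)
  []       ↭? []      = just ↭-refl
  []       ↭? (_ ∷ _) = nothing
  (x ∷ xs) ↭? ys      =
    extract x ys >>= λ (zs , ys↭) → Maybe.map (λ xs↭ → ↭-trans (↭-prep x xs↭) (↭-sym ys↭)) (xs ↭? zs)

open PermutationCheck _≟_ using (_↭?_)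
open PermutationCheck (≡-dec _≟_ _≟_) renaming (_↭?_ to _↭²?_) using ()

realization? : (L P : List ℕ) → Maybe (IsLinearRealization L P)
realization? L P = zip (P ↭? upTo (suc (length L))) (diffs P ↭? L)

cut-at? : (n k : ℕ) (P : List ℕ) (t : ℕ) → Maybe (Cut n k P)
cut-at? n k P t with t <? n | (suc t ∸ k) + k ≟ suc t | crossings t P ↭²? spans (suc t ∸ k) k k
... | yes t<n | yes first+k | just crossers =
  just (record { gap = t ; first = suc t ∸ k ; first+k = first+k ; gap<n = t<n ; crossers = crossers })
... | _ | _ | _ = nothing

cut? : (n k : ℕ) (P : List ℕ) → Maybe (Cut n k P)
cut? n k P = foldr (λ t found → cut-at? n k P t <∣> found) nothing (upTo n)

when? : {A B : Set} → Dec A → Maybe B → Maybe (A → B)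
when? (yes _)  mb = Maybe.map (λ b _ → b) mb
when? (no ¬a)  _  = just (λ a → contradiction a ¬a)

-- Seeds.  The seed for (b, c, d) must carry a k-cut for each k ∈ {2, 3, 4} of
-- which it has more than k copies: exactly the sizes by which it will be grown.
Wanted : ℕ → ℕ → ℕ → ℕ → Set
Wanted b c d 2 = 2 < b
Wanted b c d 3 = 3 < c
Wanted b c d 4 = 4 < d
Wanted b c d _ = ⊥

select : ∀ {b c d n P} k → (2 < b → Cut n 2 P) → (3 < c → Cut n 3 P) → (4 < d → Cut n 4 P) →
  Wanted b c d k → Cut n k P
select 2 cut₂ _    _    w = cut₂ w
select 3 _    cut₃ _    w = cut₃ w
select 4 _    _    cut₄ w = cut₄ w
select 0 _    _    _    ()
select 1 _    _    _    ()
select (suc (suc (suc (suc (suc _))))) _ _ _ ()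

seed-path : ℕ → ℕ → ℕ → List ℕ
seed-path 1 1 1 = 0 ∷ 4 ∷ 1 ∷ 2 ∷ 3 ∷ 5 ∷ []
seed-path 1 1 2 = 0 ∷ 4 ∷ 1 ∷ 3 ∷ 2 ∷ 6 ∷ 5 ∷ []
seed-path 1 1 3 = 0 ∷ 4 ∷ 7 ∷ 3 ∷ 5 ∷ 6 ∷ 2 ∷ 1 ∷ []
seed-path 1 1 4 = 0 ∷ 4 ∷ 6 ∷ 2 ∷ 3 ∷ 7 ∷ 8 ∷ 5 ∷ 1 ∷ []
seed-path 1 1 5 = 0 ∷ 4 ∷ 8 ∷ 9 ∷ 5 ∷ 2 ∷ 6 ∷ 7 ∷ 3 ∷ 1 ∷ []
seed-path 1 1 6 = 0 ∷ 4 ∷ 8 ∷ 9 ∷ 5 ∷ 3 ∷ 7 ∷ 10 ∷ 6 ∷ 2 ∷ 1 ∷ []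
seed-path 1 1 7 = 0 ∷ 4 ∷ 8 ∷ 11 ∷ 7 ∷ 3 ∷ 5 ∷ 9 ∷ 10 ∷ 6 ∷ 2 ∷ 1 ∷ []
seed-path 1 1 8 = 0 ∷ 4 ∷ 8 ∷ 12 ∷ 9 ∷ 5 ∷ 1 ∷ 3 ∷ 2 ∷ 6 ∷ 10 ∷ 11 ∷ 7 ∷ []
seed-path 1 2 1 = 0 ∷ 4 ∷ 1 ∷ 3 ∷ 2 ∷ 5 ∷ 6 ∷ []
seed-path 1 2 2 = 0 ∷ 4 ∷ 7 ∷ 3 ∷ 1 ∷ 2 ∷ 5 ∷ 6 ∷ []
seed-path 1 2 3 = 0 ∷ 4 ∷ 8 ∷ 5 ∷ 2 ∷ 1 ∷ 3 ∷ 7 ∷ 6 ∷ []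
seed-path 1 2 4 = 0 ∷ 1 ∷ 4 ∷ 8 ∷ 7 ∷ 3 ∷ 5 ∷ 9 ∷ 6 ∷ 2 ∷ []
seed-path 1 2 5 = 0 ∷ 4 ∷ 8 ∷ 9 ∷ 5 ∷ 2 ∷ 1 ∷ 3 ∷ 7 ∷ 10 ∷ 6 ∷ []
seed-path 1 2 6 = 0 ∷ 4 ∷ 8 ∷ 11 ∷ 7 ∷ 3 ∷ 1 ∷ 2 ∷ 5 ∷ 9 ∷ 10 ∷ 6 ∷ []
seed-path 1 2 7 = 0 ∷ 4 ∷ 8 ∷ 12 ∷ 9 ∷ 5 ∷ 2 ∷ 1 ∷ 3 ∷ 7 ∷ 11 ∷ 10 ∷ 6 ∷ []
seed-path 1 2 8 = 0 ∷ 4 ∷ 8 ∷ 12 ∷ 13 ∷ 9 ∷ 6 ∷ 10 ∷ 11 ∷ 7 ∷ 3 ∷ 1 ∷ 5 ∷ 2 ∷ []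
seed-path 1 3 1 = 0 ∷ 4 ∷ 7 ∷ 6 ∷ 3 ∷ 1 ∷ 2 ∷ 5 ∷ []
seed-path 1 3 2 = 1 ∷ 5 ∷ 8 ∷ 7 ∷ 4 ∷ 0 ∷ 2 ∷ 3 ∷ 6 ∷ []
seed-path 1 3 3 = 0 ∷ 3 ∷ 7 ∷ 6 ∷ 8 ∷ 4 ∷ 1 ∷ 2 ∷ 5 ∷ 9 ∷ []
seed-path 1 3 4 = 1 ∷ 4 ∷ 8 ∷ 7 ∷ 3 ∷ 0 ∷ 2 ∷ 5 ∷ 9 ∷ 10 ∷ 6 ∷ []
seed-path 1 3 5 = 1 ∷ 4 ∷ 8 ∷ 9 ∷ 5 ∷ 2 ∷ 0 ∷ 3 ∷ 7 ∷ 11 ∷ 10 ∷ 6 ∷ []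
seed-path 1 3 6 = 1 ∷ 4 ∷ 8 ∷ 12 ∷ 11 ∷ 7 ∷ 3 ∷ 0 ∷ 2 ∷ 5 ∷ 9 ∷ 10 ∷ 6 ∷ []
seed-path 1 3 7 = 1 ∷ 4 ∷ 8 ∷ 12 ∷ 13 ∷ 9 ∷ 5 ∷ 2 ∷ 0 ∷ 3 ∷ 7 ∷ 11 ∷ 10 ∷ 6 ∷ []
seed-path 1 3 8 = 1 ∷ 4 ∷ 8 ∷ 12 ∷ 11 ∷ 7 ∷ 3 ∷ 0 ∷ 2 ∷ 5 ∷ 9 ∷ 13 ∷ 14 ∷ 10 ∷ 6 ∷ []
seed-path 1 4 1 = 0 ∷ 4 ∷ 7 ∷ 8 ∷ 5 ∷ 2 ∷ 1 ∷ 3 ∷ 6 ∷ []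
seed-path 1 4 2 = 0 ∷ 4 ∷ 7 ∷ 9 ∷ 6 ∷ 3 ∷ 2 ∷ 1 ∷ 5 ∷ 8 ∷ []
seed-path 1 4 3 = 2 ∷ 1 ∷ 5 ∷ 8 ∷ 9 ∷ 7 ∷ 4 ∷ 0 ∷ 3 ∷ 6 ∷ 10 ∷ []
seed-path 1 4 4 = 1 ∷ 4 ∷ 8 ∷ 11 ∷ 7 ∷ 6 ∷ 10 ∷ 9 ∷ 5 ∷ 2 ∷ 0 ∷ 3 ∷ []
seed-path 1 4 5 = 0 ∷ 3 ∷ 7 ∷ 11 ∷ 12 ∷ 9 ∷ 5 ∷ 2 ∷ 1 ∷ 4 ∷ 8 ∷ 10 ∷ 6 ∷ []
seed-path 1 4 6 = 0 ∷ 3 ∷ 7 ∷ 11 ∷ 8 ∷ 4 ∷ 1 ∷ 2 ∷ 5 ∷ 9 ∷ 13 ∷ 12 ∷ 10 ∷ 6 ∷ []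
seed-path 1 4 7 = 0 ∷ 3 ∷ 7 ∷ 11 ∷ 14 ∷ 13 ∷ 9 ∷ 5 ∷ 2 ∷ 1 ∷ 4 ∷ 8 ∷ 12 ∷ 10 ∷ 6 ∷ []
seed-path 1 4 8 = 1 ∷ 4 ∷ 8 ∷ 12 ∷ 13 ∷ 9 ∷ 5 ∷ 2 ∷ 0 ∷ 3 ∷ 6 ∷ 10 ∷ 14 ∷ 15 ∷ 11 ∷ 7 ∷ []
seed-path 1 5 1 = 0 ∷ 4 ∷ 7 ∷ 8 ∷ 5 ∷ 2 ∷ 1 ∷ 3 ∷ 6 ∷ 9 ∷ []
seed-path 1 5 2 = 0 ∷ 4 ∷ 7 ∷ 10 ∷ 6 ∷ 3 ∷ 1 ∷ 2 ∷ 5 ∷ 8 ∷ 9 ∷ []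
seed-path 1 5 3 = 0 ∷ 4 ∷ 7 ∷ 10 ∷ 11 ∷ 8 ∷ 5 ∷ 1 ∷ 3 ∷ 2 ∷ 6 ∷ 9 ∷ []
seed-path 1 5 4 = 0 ∷ 3 ∷ 6 ∷ 10 ∷ 8 ∷ 4 ∷ 1 ∷ 2 ∷ 5 ∷ 9 ∷ 12 ∷ 11 ∷ 7 ∷ []
seed-path 1 5 5 = 0 ∷ 3 ∷ 6 ∷ 10 ∷ 13 ∷ 12 ∷ 8 ∷ 4 ∷ 1 ∷ 2 ∷ 5 ∷ 9 ∷ 11 ∷ 7 ∷ []
seed-path 1 5 6 = 0 ∷ 3 ∷ 6 ∷ 10 ∷ 14 ∷ 11 ∷ 7 ∷ 9 ∷ 13 ∷ 12 ∷ 8 ∷ 4 ∷ 1 ∷ 2 ∷ 5 ∷ []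
seed-path 1 5 7 = 0 ∷ 3 ∷ 6 ∷ 10 ∷ 14 ∷ 15 ∷ 12 ∷ 8 ∷ 4 ∷ 1 ∷ 2 ∷ 5 ∷ 9 ∷ 13 ∷ 11 ∷ 7 ∷ []
seed-path 1 5 8 = 0 ∷ 3 ∷ 6 ∷ 10 ∷ 14 ∷ 12 ∷ 8 ∷ 4 ∷ 1 ∷ 2 ∷ 5 ∷ 9 ∷ 13 ∷ 16 ∷ 15 ∷ 11 ∷ 7 ∷ []
seed-path 1 6 1 = 0 ∷ 4 ∷ 7 ∷ 10 ∷ 9 ∷ 6 ∷ 3 ∷ 1 ∷ 2 ∷ 5 ∷ 8 ∷ []
seed-path 1 6 2 = 0 ∷ 3 ∷ 2 ∷ 6 ∷ 9 ∷ 11 ∷ 10 ∷ 7 ∷ 4 ∷ 1 ∷ 5 ∷ 8 ∷ []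
seed-path 1 6 3 = 0 ∷ 4 ∷ 7 ∷ 10 ∷ 11 ∷ 8 ∷ 5 ∷ 1 ∷ 3 ∷ 2 ∷ 6 ∷ 9 ∷ 12 ∷ []
seed-path 1 6 4 = 1 ∷ 4 ∷ 8 ∷ 11 ∷ 7 ∷ 6 ∷ 10 ∷ 13 ∷ 12 ∷ 9 ∷ 5 ∷ 2 ∷ 0 ∷ 3 ∷ []
seed-path 1 6 5 = 0 ∷ 3 ∷ 6 ∷ 10 ∷ 14 ∷ 11 ∷ 7 ∷ 9 ∷ 13 ∷ 12 ∷ 8 ∷ 5 ∷ 2 ∷ 1 ∷ 4 ∷ []
seed-path 1 6 6 = 0 ∷ 3 ∷ 6 ∷ 10 ∷ 14 ∷ 11 ∷ 7 ∷ 8 ∷ 12 ∷ 15 ∷ 13 ∷ 9 ∷ 5 ∷ 2 ∷ 1 ∷ 4 ∷ []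
seed-path 1 6 7 = 0 ∷ 3 ∷ 6 ∷ 10 ∷ 14 ∷ 11 ∷ 7 ∷ 4 ∷ 1 ∷ 2 ∷ 5 ∷ 9 ∷ 13 ∷ 15 ∷ 16 ∷ 12 ∷ 8 ∷ []
seed-path 1 6 8 = 0 ∷ 4 ∷ 7 ∷ 11 ∷ 15 ∷ 16 ∷ 12 ∷ 8 ∷ 5 ∷ 2 ∷ 1 ∷ 3 ∷ 6 ∷ 9 ∷ 13 ∷ 17 ∷ 14 ∷ 10 ∷ []
seed-path 2 1 1 = 0 ∷ 4 ∷ 6 ∷ 5 ∷ 2 ∷ 3 ∷ 1 ∷ []
seed-path 2 1 2 = 0 ∷ 2 ∷ 6 ∷ 5 ∷ 4 ∷ 7 ∷ 3 ∷ 1 ∷ []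
seed-path 2 1 3 = 0 ∷ 4 ∷ 1 ∷ 5 ∷ 7 ∷ 8 ∷ 6 ∷ 2 ∷ 3 ∷ []
seed-path 2 1 4 = 0 ∷ 2 ∷ 6 ∷ 9 ∷ 5 ∷ 4 ∷ 8 ∷ 7 ∷ 3 ∷ 1 ∷ []
seed-path 2 1 5 = 0 ∷ 3 ∷ 7 ∷ 9 ∷ 5 ∷ 4 ∷ 8 ∷ 10 ∷ 6 ∷ 2 ∷ 1 ∷ []
seed-path 2 1 6 = 1 ∷ 5 ∷ 9 ∷ 11 ∷ 10 ∷ 8 ∷ 4 ∷ 0 ∷ 3 ∷ 7 ∷ 6 ∷ 2 ∷ []
seed-path 2 1 7 = 0 ∷ 4 ∷ 8 ∷ 12 ∷ 9 ∷ 5 ∷ 7 ∷ 11 ∷ 10 ∷ 6 ∷ 2 ∷ 3 ∷ 1 ∷ []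
seed-path 2 1 8 = 0 ∷ 2 ∷ 6 ∷ 10 ∷ 13 ∷ 9 ∷ 5 ∷ 4 ∷ 8 ∷ 12 ∷ 11 ∷ 7 ∷ 3 ∷ 1 ∷ []
seed-path 2 2 1 = 4 ∷ 7 ∷ 3 ∷ 1 ∷ 0 ∷ 2 ∷ 5 ∷ 6 ∷ []
seed-path 2 2 2 = 0 ∷ 4 ∷ 1 ∷ 5 ∷ 7 ∷ 8 ∷ 6 ∷ 3 ∷ 2 ∷ []
seed-path 2 2 3 = 0 ∷ 4 ∷ 1 ∷ 5 ∷ 2 ∷ 3 ∷ 7 ∷ 9 ∷ 8 ∷ 6 ∷ []
seed-path 2 2 4 = 8 ∷ 4 ∷ 5 ∷ 9 ∷ 6 ∷ 2 ∷ 0 ∷ 1 ∷ 3 ∷ 7 ∷ 10 ∷ []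
seed-path 2 2 5 = 4 ∷ 8 ∷ 11 ∷ 7 ∷ 3 ∷ 1 ∷ 0 ∷ 2 ∷ 5 ∷ 9 ∷ 10 ∷ 6 ∷ []
seed-path 2 2 6 = 3 ∷ 1 ∷ 0 ∷ 2 ∷ 6 ∷ 10 ∷ 11 ∷ 7 ∷ 4 ∷ 8 ∷ 12 ∷ 9 ∷ 5 ∷ []
seed-path 2 2 7 = 0 ∷ 4 ∷ 8 ∷ 12 ∷ 13 ∷ 9 ∷ 7 ∷ 11 ∷ 10 ∷ 6 ∷ 3 ∷ 1 ∷ 5 ∷ 2 ∷ []
seed-path 2 2 8 = 0 ∷ 3 ∷ 7 ∷ 11 ∷ 13 ∷ 14 ∷ 12 ∷ 8 ∷ 4 ∷ 1 ∷ 5 ∷ 9 ∷ 10 ∷ 6 ∷ 2 ∷ []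
seed-path 2 3 1 = 0 ∷ 4 ∷ 7 ∷ 5 ∷ 8 ∷ 6 ∷ 3 ∷ 2 ∷ 1 ∷ []
seed-path 2 3 2 = 0 ∷ 4 ∷ 8 ∷ 5 ∷ 2 ∷ 1 ∷ 3 ∷ 6 ∷ 7 ∷ 9 ∷ []
seed-path 2 3 3 = 0 ∷ 4 ∷ 8 ∷ 5 ∷ 2 ∷ 1 ∷ 3 ∷ 6 ∷ 10 ∷ 9 ∷ 7 ∷ []
seed-path 2 3 4 = 0 ∷ 4 ∷ 8 ∷ 11 ∷ 7 ∷ 10 ∷ 9 ∷ 6 ∷ 2 ∷ 1 ∷ 3 ∷ 5 ∷ []
seed-path 2 3 5 = 0 ∷ 4 ∷ 7 ∷ 11 ∷ 9 ∷ 5 ∷ 8 ∷ 12 ∷ 10 ∷ 6 ∷ 3 ∷ 2 ∷ 1 ∷ []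
seed-path 2 3 6 = 0 ∷ 4 ∷ 8 ∷ 12 ∷ 11 ∷ 7 ∷ 9 ∷ 13 ∷ 10 ∷ 6 ∷ 3 ∷ 5 ∷ 2 ∷ 1 ∷ []
seed-path 2 3 7 = 0 ∷ 4 ∷ 8 ∷ 12 ∷ 14 ∷ 11 ∷ 7 ∷ 3 ∷ 1 ∷ 2 ∷ 5 ∷ 6 ∷ 10 ∷ 13 ∷ 9 ∷ []
seed-path 2 3 8 = 0 ∷ 4 ∷ 8 ∷ 12 ∷ 15 ∷ 11 ∷ 7 ∷ 10 ∷ 14 ∷ 13 ∷ 9 ∷ 6 ∷ 2 ∷ 1 ∷ 3 ∷ 5 ∷ []
seed-path 2 4 1 = 0 ∷ 4 ∷ 7 ∷ 9 ∷ 8 ∷ 5 ∷ 2 ∷ 1 ∷ 3 ∷ 6 ∷ []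
seed-path 2 4 2 = 4 ∷ 7 ∷ 10 ∷ 6 ∷ 3 ∷ 1 ∷ 0 ∷ 2 ∷ 5 ∷ 9 ∷ 8 ∷ []
seed-path 2 4 3 = 1 ∷ 5 ∷ 8 ∷ 10 ∷ 11 ∷ 9 ∷ 6 ∷ 2 ∷ 3 ∷ 0 ∷ 4 ∷ 7 ∷ []
seed-path 2 4 4 = 4 ∷ 7 ∷ 11 ∷ 10 ∷ 6 ∷ 3 ∷ 1 ∷ 0 ∷ 2 ∷ 5 ∷ 9 ∷ 12 ∷ 8 ∷ []
seed-path 2 4 5 = 0 ∷ 3 ∷ 7 ∷ 11 ∷ 13 ∷ 12 ∷ 9 ∷ 5 ∷ 2 ∷ 1 ∷ 4 ∷ 8 ∷ 10 ∷ 6 ∷ []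
seed-path 2 4 6 = 0 ∷ 3 ∷ 6 ∷ 10 ∷ 14 ∷ 12 ∷ 8 ∷ 7 ∷ 11 ∷ 13 ∷ 9 ∷ 5 ∷ 2 ∷ 1 ∷ 4 ∷ []
seed-path 2 4 7 = 0 ∷ 3 ∷ 6 ∷ 10 ∷ 14 ∷ 12 ∷ 8 ∷ 7 ∷ 11 ∷ 15 ∷ 13 ∷ 9 ∷ 5 ∷ 2 ∷ 1 ∷ 4 ∷ []
seed-path 2 4 8 = 0 ∷ 3 ∷ 6 ∷ 10 ∷ 14 ∷ 16 ∷ 12 ∷ 8 ∷ 7 ∷ 11 ∷ 15 ∷ 13 ∷ 9 ∷ 5 ∷ 2 ∷ 1 ∷ 4 ∷ []
seed-path 2 5 1 = 4 ∷ 7 ∷ 10 ∷ 6 ∷ 3 ∷ 1 ∷ 0 ∷ 2 ∷ 5 ∷ 8 ∷ 9 ∷ []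
seed-path 2 5 2 = 0 ∷ 3 ∷ 2 ∷ 6 ∷ 9 ∷ 11 ∷ 10 ∷ 8 ∷ 5 ∷ 1 ∷ 4 ∷ 7 ∷ []
seed-path 2 5 3 = 3 ∷ 0 ∷ 4 ∷ 7 ∷ 10 ∷ 12 ∷ 11 ∷ 9 ∷ 6 ∷ 2 ∷ 1 ∷ 5 ∷ 8 ∷ []
seed-path 2 5 4 = 4 ∷ 0 ∷ 3 ∷ 7 ∷ 10 ∷ 12 ∷ 13 ∷ 11 ∷ 8 ∷ 5 ∷ 1 ∷ 2 ∷ 6 ∷ 9 ∷ []
seed-path 2 5 5 = 4 ∷ 7 ∷ 11 ∷ 14 ∷ 10 ∷ 6 ∷ 3 ∷ 1 ∷ 0 ∷ 2 ∷ 5 ∷ 8 ∷ 12 ∷ 13 ∷ 9 ∷ []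
seed-path 2 5 6 = 0 ∷ 3 ∷ 6 ∷ 10 ∷ 14 ∷ 12 ∷ 8 ∷ 9 ∷ 13 ∷ 15 ∷ 11 ∷ 7 ∷ 4 ∷ 1 ∷ 2 ∷ 5 ∷ []
seed-path 2 5 7 = 0 ∷ 3 ∷ 6 ∷ 10 ∷ 14 ∷ 16 ∷ 15 ∷ 12 ∷ 8 ∷ 4 ∷ 1 ∷ 2 ∷ 5 ∷ 9 ∷ 13 ∷ 11 ∷ 7 ∷ []
seed-path 2 5 8 = 0 ∷ 4 ∷ 7 ∷ 11 ∷ 15 ∷ 16 ∷ 12 ∷ 8 ∷ 10 ∷ 14 ∷ 17 ∷ 13 ∷ 9 ∷ 6 ∷ 3 ∷ 1 ∷ 2 ∷ 5 ∷ []
seed-path 2 6 1 = 4 ∷ 7 ∷ 11 ∷ 8 ∷ 5 ∷ 2 ∷ 0 ∷ 1 ∷ 3 ∷ 6 ∷ 9 ∷ 10 ∷ []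
seed-path 2 6 2 = 0 ∷ 3 ∷ 2 ∷ 6 ∷ 9 ∷ 11 ∷ 12 ∷ 10 ∷ 7 ∷ 4 ∷ 1 ∷ 5 ∷ 8 ∷ []
seed-path 2 6 3 = 1 ∷ 5 ∷ 8 ∷ 11 ∷ 13 ∷ 12 ∷ 10 ∷ 7 ∷ 4 ∷ 0 ∷ 3 ∷ 2 ∷ 6 ∷ 9 ∷ []
seed-path 2 6 4 = 0 ∷ 4 ∷ 8 ∷ 11 ∷ 14 ∷ 13 ∷ 10 ∷ 7 ∷ 5 ∷ 1 ∷ 3 ∷ 2 ∷ 6 ∷ 9 ∷ 12 ∷ []
seed-path 2 6 5 = 0 ∷ 3 ∷ 6 ∷ 9 ∷ 13 ∷ 11 ∷ 7 ∷ 5 ∷ 2 ∷ 1 ∷ 4 ∷ 8 ∷ 12 ∷ 15 ∷ 14 ∷ 10 ∷ []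
seed-path 2 6 6 = 0 ∷ 3 ∷ 6 ∷ 10 ∷ 14 ∷ 16 ∷ 13 ∷ 15 ∷ 11 ∷ 7 ∷ 8 ∷ 12 ∷ 9 ∷ 5 ∷ 2 ∷ 1 ∷ 4 ∷ []
seed-path 2 6 7 = 0 ∷ 3 ∷ 7 ∷ 11 ∷ 14 ∷ 16 ∷ 17 ∷ 15 ∷ 12 ∷ 8 ∷ 4 ∷ 1 ∷ 2 ∷ 5 ∷ 9 ∷ 13 ∷ 10 ∷ 6 ∷ []
seed-path 2 6 8 = 0 ∷ 4 ∷ 7 ∷ 11 ∷ 15 ∷ 18 ∷ 17 ∷ 13 ∷ 9 ∷ 6 ∷ 3 ∷ 1 ∷ 2 ∷ 5 ∷ 8 ∷ 12 ∷ 16 ∷ 14 ∷ 10 ∷ []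
seed-path 3 1 1 = 0 ∷ 2 ∷ 6 ∷ 7 ∷ 4 ∷ 5 ∷ 3 ∷ 1 ∷ []
seed-path 3 1 2 = 0 ∷ 4 ∷ 1 ∷ 3 ∷ 2 ∷ 6 ∷ 8 ∷ 7 ∷ 5 ∷ []
seed-path 3 1 3 = 0 ∷ 4 ∷ 7 ∷ 9 ∷ 8 ∷ 6 ∷ 2 ∷ 3 ∷ 5 ∷ 1 ∷ []
seed-path 3 1 4 = 0 ∷ 2 ∷ 6 ∷ 8 ∷ 4 ∷ 5 ∷ 9 ∷ 10 ∷ 7 ∷ 3 ∷ 1 ∷ []
seed-path 3 1 5 = 0 ∷ 4 ∷ 8 ∷ 10 ∷ 11 ∷ 9 ∷ 5 ∷ 2 ∷ 6 ∷ 7 ∷ 3 ∷ 1 ∷ []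
seed-path 3 1 6 = 0 ∷ 2 ∷ 6 ∷ 10 ∷ 8 ∷ 4 ∷ 5 ∷ 9 ∷ 12 ∷ 11 ∷ 7 ∷ 3 ∷ 1 ∷ []
seed-path 3 1 7 = 0 ∷ 2 ∷ 6 ∷ 10 ∷ 13 ∷ 9 ∷ 5 ∷ 7 ∷ 11 ∷ 12 ∷ 8 ∷ 4 ∷ 3 ∷ 1 ∷ []
seed-path 3 1 8 = 1 ∷ 5 ∷ 9 ∷ 8 ∷ 4 ∷ 0 ∷ 3 ∷ 7 ∷ 11 ∷ 13 ∷ 14 ∷ 12 ∷ 10 ∷ 6 ∷ 2 ∷ []
seed-path 3 2 1 = 0 ∷ 4 ∷ 1 ∷ 3 ∷ 2 ∷ 5 ∷ 7 ∷ 8 ∷ 6 ∷ []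
seed-path 3 2 2 = 0 ∷ 4 ∷ 7 ∷ 9 ∷ 8 ∷ 6 ∷ 3 ∷ 5 ∷ 1 ∷ 2 ∷ []
seed-path 3 2 3 = 1 ∷ 5 ∷ 7 ∷ 10 ∷ 9 ∷ 8 ∷ 6 ∷ 2 ∷ 4 ∷ 0 ∷ 3 ∷ []
seed-path 3 2 4 = 2 ∷ 0 ∷ 1 ∷ 3 ∷ 6 ∷ 10 ∷ 9 ∷ 5 ∷ 7 ∷ 11 ∷ 8 ∷ 4 ∷ []
seed-path 3 2 5 = 0 ∷ 4 ∷ 7 ∷ 3 ∷ 1 ∷ 5 ∷ 8 ∷ 9 ∷ 11 ∷ 12 ∷ 10 ∷ 6 ∷ 2 ∷ []
seed-path 3 2 6 = 0 ∷ 1 ∷ 3 ∷ 7 ∷ 11 ∷ 13 ∷ 10 ∷ 6 ∷ 5 ∷ 9 ∷ 12 ∷ 8 ∷ 4 ∷ 2 ∷ []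
seed-path 3 2 7 = 0 ∷ 4 ∷ 8 ∷ 12 ∷ 14 ∷ 13 ∷ 11 ∷ 10 ∷ 7 ∷ 3 ∷ 1 ∷ 5 ∷ 9 ∷ 6 ∷ 2 ∷ []
seed-path 3 2 8 = 0 ∷ 4 ∷ 8 ∷ 10 ∷ 14 ∷ 11 ∷ 15 ∷ 12 ∷ 13 ∷ 9 ∷ 7 ∷ 3 ∷ 1 ∷ 5 ∷ 6 ∷ 2 ∷ []
seed-path 3 3 1 = 4 ∷ 7 ∷ 8 ∷ 6 ∷ 3 ∷ 1 ∷ 0 ∷ 2 ∷ 5 ∷ 9 ∷ []
seed-path 3 3 2 = 4 ∷ 7 ∷ 8 ∷ 10 ∷ 6 ∷ 3 ∷ 1 ∷ 0 ∷ 2 ∷ 5 ∷ 9 ∷ []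
seed-path 3 3 3 = 5 ∷ 4 ∷ 8 ∷ 11 ∷ 9 ∷ 6 ∷ 2 ∷ 0 ∷ 1 ∷ 3 ∷ 7 ∷ 10 ∷ []
seed-path 3 3 4 = 0 ∷ 4 ∷ 1 ∷ 5 ∷ 2 ∷ 6 ∷ 8 ∷ 11 ∷ 12 ∷ 10 ∷ 9 ∷ 7 ∷ 3 ∷ []
seed-path 3 3 5 = 1 ∷ 5 ∷ 7 ∷ 3 ∷ 0 ∷ 4 ∷ 8 ∷ 10 ∷ 13 ∷ 12 ∷ 11 ∷ 9 ∷ 6 ∷ 2 ∷ []
seed-path 3 3 6 = 0 ∷ 3 ∷ 7 ∷ 11 ∷ 13 ∷ 14 ∷ 12 ∷ 10 ∷ 6 ∷ 2 ∷ 5 ∷ 9 ∷ 8 ∷ 4 ∷ 1 ∷ []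
seed-path 3 3 7 = 1 ∷ 5 ∷ 9 ∷ 11 ∷ 15 ∷ 12 ∷ 14 ∷ 13 ∷ 10 ∷ 8 ∷ 4 ∷ 0 ∷ 3 ∷ 7 ∷ 6 ∷ 2 ∷ []
seed-path 3 3 8 = 0 ∷ 3 ∷ 5 ∷ 9 ∷ 13 ∷ 16 ∷ 12 ∷ 8 ∷ 6 ∷ 10 ∷ 14 ∷ 15 ∷ 11 ∷ 7 ∷ 4 ∷ 2 ∷ 1 ∷ []
seed-path 3 4 1 = 4 ∷ 7 ∷ 10 ∷ 9 ∷ 6 ∷ 2 ∷ 0 ∷ 1 ∷ 3 ∷ 5 ∷ 8 ∷ []
seed-path 3 4 2 = 4 ∷ 7 ∷ 11 ∷ 8 ∷ 5 ∷ 3 ∷ 1 ∷ 0 ∷ 2 ∷ 6 ∷ 9 ∷ 10 ∷ []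
seed-path 3 4 3 = 1 ∷ 5 ∷ 8 ∷ 10 ∷ 12 ∷ 11 ∷ 9 ∷ 6 ∷ 2 ∷ 3 ∷ 0 ∷ 4 ∷ 7 ∷ []
seed-path 3 4 4 = 1 ∷ 4 ∷ 6 ∷ 10 ∷ 13 ∷ 9 ∷ 8 ∷ 12 ∷ 11 ∷ 7 ∷ 5 ∷ 2 ∷ 0 ∷ 3 ∷ []
seed-path 3 4 5 = 4 ∷ 7 ∷ 11 ∷ 14 ∷ 13 ∷ 9 ∷ 5 ∷ 2 ∷ 0 ∷ 1 ∷ 3 ∷ 6 ∷ 10 ∷ 12 ∷ 8 ∷ []
seed-path 3 4 6 = 0 ∷ 3 ∷ 7 ∷ 11 ∷ 9 ∷ 5 ∷ 2 ∷ 1 ∷ 4 ∷ 8 ∷ 12 ∷ 14 ∷ 15 ∷ 13 ∷ 10 ∷ 6 ∷ []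
seed-path 3 4 7 = 4 ∷ 7 ∷ 11 ∷ 15 ∷ 16 ∷ 13 ∷ 9 ∷ 5 ∷ 2 ∷ 0 ∷ 1 ∷ 3 ∷ 6 ∷ 10 ∷ 14 ∷ 12 ∷ 8 ∷ []
seed-path 3 4 8 = 0 ∷ 3 ∷ 7 ∷ 11 ∷ 15 ∷ 17 ∷ 16 ∷ 14 ∷ 12 ∷ 8 ∷ 4 ∷ 1 ∷ 2 ∷ 5 ∷ 9 ∷ 13 ∷ 10 ∷ 6 ∷ []
seed-path 3 5 1 = 3 ∷ 1 ∷ 0 ∷ 2 ∷ 6 ∷ 9 ∷ 11 ∷ 8 ∷ 5 ∷ 4 ∷ 7 ∷ 10 ∷ []
seed-path 3 5 2 = 0 ∷ 3 ∷ 2 ∷ 6 ∷ 9 ∷ 11 ∷ 12 ∷ 10 ∷ 8 ∷ 5 ∷ 1 ∷ 4 ∷ 7 ∷ []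
seed-path 3 5 3 = 0 ∷ 4 ∷ 7 ∷ 10 ∷ 12 ∷ 13 ∷ 11 ∷ 8 ∷ 5 ∷ 1 ∷ 3 ∷ 2 ∷ 6 ∷ 9 ∷ []
seed-path 3 5 4 = 0 ∷ 3 ∷ 6 ∷ 10 ∷ 8 ∷ 4 ∷ 1 ∷ 2 ∷ 5 ∷ 9 ∷ 12 ∷ 14 ∷ 13 ∷ 11 ∷ 7 ∷ []
seed-path 3 5 5 = 0 ∷ 3 ∷ 6 ∷ 10 ∷ 13 ∷ 15 ∷ 14 ∷ 12 ∷ 8 ∷ 4 ∷ 1 ∷ 2 ∷ 5 ∷ 9 ∷ 11 ∷ 7 ∷ []
seed-path 3 5 6 = 0 ∷ 3 ∷ 6 ∷ 10 ∷ 12 ∷ 8 ∷ 4 ∷ 1 ∷ 2 ∷ 5 ∷ 9 ∷ 13 ∷ 15 ∷ 16 ∷ 14 ∷ 11 ∷ 7 ∷ []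
seed-path 3 5 7 = 0 ∷ 3 ∷ 6 ∷ 10 ∷ 14 ∷ 16 ∷ 17 ∷ 15 ∷ 12 ∷ 8 ∷ 4 ∷ 1 ∷ 2 ∷ 5 ∷ 9 ∷ 13 ∷ 11 ∷ 7 ∷ []
seed-path 3 5 8 = 0 ∷ 3 ∷ 6 ∷ 10 ∷ 14 ∷ 12 ∷ 8 ∷ 4 ∷ 1 ∷ 2 ∷ 5 ∷ 9 ∷ 13 ∷ 16 ∷ 18 ∷ 17 ∷ 15 ∷ 11 ∷ 7 ∷ []
seed-path 3 6 1 = 1 ∷ 2 ∷ 5 ∷ 8 ∷ 10 ∷ 12 ∷ 11 ∷ 9 ∷ 6 ∷ 3 ∷ 0 ∷ 4 ∷ 7 ∷ []
seed-path 3 6 2 = 0 ∷ 3 ∷ 2 ∷ 6 ∷ 9 ∷ 11 ∷ 13 ∷ 12 ∷ 10 ∷ 7 ∷ 4 ∷ 1 ∷ 5 ∷ 8 ∷ []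
seed-path 3 6 3 = 1 ∷ 4 ∷ 6 ∷ 9 ∷ 13 ∷ 10 ∷ 14 ∷ 11 ∷ 12 ∷ 8 ∷ 7 ∷ 5 ∷ 2 ∷ 0 ∷ 3 ∷ []
seed-path 3 6 4 = 1 ∷ 4 ∷ 7 ∷ 9 ∷ 13 ∷ 14 ∷ 10 ∷ 11 ∷ 15 ∷ 12 ∷ 8 ∷ 6 ∷ 3 ∷ 0 ∷ 2 ∷ 5 ∷ []
seed-path 3 6 5 = 0 ∷ 3 ∷ 6 ∷ 8 ∷ 12 ∷ 16 ∷ 13 ∷ 9 ∷ 11 ∷ 15 ∷ 14 ∷ 10 ∷ 7 ∷ 5 ∷ 2 ∷ 1 ∷ 4 ∷ []
seed-path 3 6 6 = 0 ∷ 3 ∷ 6 ∷ 10 ∷ 13 ∷ 9 ∷ 5 ∷ 2 ∷ 1 ∷ 4 ∷ 7 ∷ 11 ∷ 15 ∷ 17 ∷ 16 ∷ 14 ∷ 12 ∷ 8 ∷ []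
seed-path 3 6 7 = 0 ∷ 3 ∷ 7 ∷ 11 ∷ 14 ∷ 16 ∷ 18 ∷ 17 ∷ 15 ∷ 12 ∷ 8 ∷ 4 ∷ 1 ∷ 2 ∷ 5 ∷ 9 ∷ 13 ∷ 10 ∷ 6 ∷ []
seed-path 3 6 8 = 0 ∷ 3 ∷ 7 ∷ 11 ∷ 13 ∷ 17 ∷ 16 ∷ 19 ∷ 15 ∷ 18 ∷ 14 ∷ 12 ∷ 9 ∷ 5 ∷ 2 ∷ 1 ∷ 4 ∷ 8 ∷ 10 ∷ 6 ∷ []
seed-path 4 1 1 = 1 ∷ 3 ∷ 5 ∷ 8 ∷ 7 ∷ 6 ∷ 4 ∷ 0 ∷ 2 ∷ []
seed-path 4 1 2 = 0 ∷ 4 ∷ 7 ∷ 9 ∷ 8 ∷ 6 ∷ 2 ∷ 1 ∷ 3 ∷ 5 ∷ []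
seed-path 4 1 3 = 0 ∷ 4 ∷ 1 ∷ 5 ∷ 7 ∷ 9 ∷ 10 ∷ 8 ∷ 6 ∷ 2 ∷ 3 ∷ []
seed-path 4 1 4 = 0 ∷ 2 ∷ 6 ∷ 7 ∷ 3 ∷ 5 ∷ 9 ∷ 11 ∷ 10 ∷ 8 ∷ 4 ∷ 1 ∷ []
seed-path 4 1 5 = 0 ∷ 2 ∷ 6 ∷ 10 ∷ 12 ∷ 11 ∷ 7 ∷ 4 ∷ 8 ∷ 9 ∷ 5 ∷ 3 ∷ 1 ∷ []
seed-path 4 1 6 = 1 ∷ 5 ∷ 9 ∷ 11 ∷ 13 ∷ 12 ∷ 10 ∷ 8 ∷ 4 ∷ 0 ∷ 3 ∷ 7 ∷ 6 ∷ 2 ∷ []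
seed-path 4 1 7 = 0 ∷ 4 ∷ 8 ∷ 11 ∷ 13 ∷ 14 ∷ 12 ∷ 10 ∷ 6 ∷ 2 ∷ 3 ∷ 7 ∷ 9 ∷ 5 ∷ 1 ∷ []
seed-path 4 1 8 = 1 ∷ 5 ∷ 9 ∷ 11 ∷ 15 ∷ 13 ∷ 12 ∷ 14 ∷ 10 ∷ 8 ∷ 4 ∷ 0 ∷ 3 ∷ 7 ∷ 6 ∷ 2 ∷ []
seed-path 4 2 1 = 0 ∷ 4 ∷ 6 ∷ 9 ∷ 7 ∷ 8 ∷ 5 ∷ 3 ∷ 1 ∷ 2 ∷ []
seed-path 4 2 2 = 0 ∷ 4 ∷ 1 ∷ 5 ∷ 7 ∷ 9 ∷ 10 ∷ 8 ∷ 6 ∷ 3 ∷ 2 ∷ []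
seed-path 4 2 3 = 0 ∷ 4 ∷ 1 ∷ 5 ∷ 2 ∷ 3 ∷ 7 ∷ 9 ∷ 11 ∷ 10 ∷ 8 ∷ 6 ∷ []
seed-path 4 2 4 = 0 ∷ 3 ∷ 7 ∷ 9 ∷ 11 ∷ 12 ∷ 10 ∷ 8 ∷ 4 ∷ 1 ∷ 5 ∷ 6 ∷ 2 ∷ []
seed-path 4 2 5 = 0 ∷ 4 ∷ 7 ∷ 3 ∷ 1 ∷ 5 ∷ 8 ∷ 9 ∷ 11 ∷ 13 ∷ 12 ∷ 10 ∷ 6 ∷ 2 ∷ []
seed-path 4 2 6 = 0 ∷ 4 ∷ 8 ∷ 11 ∷ 13 ∷ 14 ∷ 12 ∷ 10 ∷ 6 ∷ 3 ∷ 7 ∷ 9 ∷ 5 ∷ 1 ∷ 2 ∷ []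
seed-path 4 2 7 = 0 ∷ 4 ∷ 8 ∷ 10 ∷ 13 ∷ 14 ∷ 12 ∷ 15 ∷ 11 ∷ 9 ∷ 5 ∷ 1 ∷ 3 ∷ 7 ∷ 6 ∷ 2 ∷ []
seed-path 4 2 8 = 0 ∷ 4 ∷ 8 ∷ 12 ∷ 14 ∷ 15 ∷ 16 ∷ 13 ∷ 11 ∷ 9 ∷ 5 ∷ 1 ∷ 3 ∷ 7 ∷ 10 ∷ 6 ∷ 2 ∷ []
seed-path 4 3 1 = 3 ∷ 1 ∷ 0 ∷ 2 ∷ 6 ∷ 9 ∷ 7 ∷ 4 ∷ 5 ∷ 8 ∷ 10 ∷ []
seed-path 4 3 2 = 3 ∷ 1 ∷ 0 ∷ 2 ∷ 6 ∷ 9 ∷ 11 ∷ 7 ∷ 4 ∷ 5 ∷ 8 ∷ 10 ∷ []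
seed-path 4 3 3 = 1 ∷ 3 ∷ 6 ∷ 10 ∷ 12 ∷ 11 ∷ 9 ∷ 5 ∷ 2 ∷ 0 ∷ 4 ∷ 7 ∷ 8 ∷ []
seed-path 4 3 4 = 2 ∷ 5 ∷ 7 ∷ 11 ∷ 13 ∷ 9 ∷ 8 ∷ 12 ∷ 10 ∷ 6 ∷ 4 ∷ 1 ∷ 0 ∷ 3 ∷ []
seed-path 4 3 5 = 0 ∷ 2 ∷ 5 ∷ 9 ∷ 10 ∷ 6 ∷ 3 ∷ 1 ∷ 4 ∷ 8 ∷ 12 ∷ 14 ∷ 13 ∷ 11 ∷ 7 ∷ []
seed-path 4 3 6 = 1 ∷ 4 ∷ 8 ∷ 12 ∷ 14 ∷ 15 ∷ 13 ∷ 11 ∷ 7 ∷ 3 ∷ 0 ∷ 2 ∷ 5 ∷ 9 ∷ 10 ∷ 6 ∷ []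
seed-path 4 3 7 = 0 ∷ 2 ∷ 5 ∷ 9 ∷ 13 ∷ 15 ∷ 16 ∷ 14 ∷ 10 ∷ 6 ∷ 3 ∷ 1 ∷ 4 ∷ 8 ∷ 12 ∷ 11 ∷ 7 ∷ []
seed-path 4 3 8 = 0 ∷ 4 ∷ 7 ∷ 9 ∷ 13 ∷ 17 ∷ 14 ∷ 10 ∷ 11 ∷ 15 ∷ 16 ∷ 12 ∷ 8 ∷ 6 ∷ 2 ∷ 5 ∷ 3 ∷ 1 ∷ []
seed-path 4 4 1 = 2 ∷ 0 ∷ 1 ∷ 3 ∷ 6 ∷ 9 ∷ 11 ∷ 7 ∷ 4 ∷ 5 ∷ 8 ∷ 10 ∷ []
seed-path 4 4 2 = 1 ∷ 5 ∷ 8 ∷ 10 ∷ 12 ∷ 11 ∷ 9 ∷ 6 ∷ 2 ∷ 0 ∷ 3 ∷ 4 ∷ 7 ∷ []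
seed-path 4 4 3 = 0 ∷ 4 ∷ 7 ∷ 10 ∷ 12 ∷ 13 ∷ 11 ∷ 9 ∷ 6 ∷ 2 ∷ 3 ∷ 1 ∷ 5 ∷ 8 ∷ []
seed-path 4 4 4 = 1 ∷ 4 ∷ 8 ∷ 9 ∷ 5 ∷ 2 ∷ 0 ∷ 3 ∷ 6 ∷ 10 ∷ 12 ∷ 14 ∷ 13 ∷ 11 ∷ 7 ∷ []
seed-path 4 4 5 = 0 ∷ 3 ∷ 7 ∷ 11 ∷ 13 ∷ 15 ∷ 14 ∷ 12 ∷ 9 ∷ 5 ∷ 2 ∷ 1 ∷ 4 ∷ 8 ∷ 10 ∷ 6 ∷ []
seed-path 4 4 6 = 0 ∷ 4 ∷ 7 ∷ 11 ∷ 14 ∷ 16 ∷ 15 ∷ 13 ∷ 9 ∷ 5 ∷ 2 ∷ 1 ∷ 3 ∷ 6 ∷ 10 ∷ 12 ∷ 8 ∷ []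
seed-path 4 4 7 = 0 ∷ 3 ∷ 6 ∷ 8 ∷ 12 ∷ 16 ∷ 14 ∷ 10 ∷ 9 ∷ 13 ∷ 17 ∷ 15 ∷ 11 ∷ 7 ∷ 5 ∷ 2 ∷ 1 ∷ 4 ∷ []
seed-path 4 4 8 = 0 ∷ 4 ∷ 7 ∷ 11 ∷ 15 ∷ 17 ∷ 18 ∷ 16 ∷ 13 ∷ 9 ∷ 6 ∷ 2 ∷ 3 ∷ 1 ∷ 5 ∷ 8 ∷ 12 ∷ 14 ∷ 10 ∷ []
seed-path 4 5 1 = 0 ∷ 3 ∷ 6 ∷ 9 ∷ 11 ∷ 12 ∷ 10 ∷ 8 ∷ 5 ∷ 1 ∷ 2 ∷ 4 ∷ 7 ∷ []
seed-path 4 5 2 = 0 ∷ 4 ∷ 7 ∷ 10 ∷ 12 ∷ 13 ∷ 11 ∷ 8 ∷ 5 ∷ 3 ∷ 1 ∷ 2 ∷ 6 ∷ 9 ∷ []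
seed-path 4 5 3 = 0 ∷ 4 ∷ 7 ∷ 9 ∷ 13 ∷ 10 ∷ 14 ∷ 12 ∷ 11 ∷ 8 ∷ 6 ∷ 3 ∷ 1 ∷ 2 ∷ 5 ∷ []
seed-path 4 5 4 = 0 ∷ 3 ∷ 6 ∷ 10 ∷ 8 ∷ 4 ∷ 1 ∷ 2 ∷ 5 ∷ 9 ∷ 12 ∷ 14 ∷ 15 ∷ 13 ∷ 11 ∷ 7 ∷ []
seed-path 4 5 5 = 0 ∷ 3 ∷ 6 ∷ 10 ∷ 12 ∷ 8 ∷ 4 ∷ 1 ∷ 2 ∷ 5 ∷ 7 ∷ 11 ∷ 14 ∷ 16 ∷ 15 ∷ 13 ∷ 9 ∷ []
seed-path 4 5 6 = 0 ∷ 3 ∷ 6 ∷ 10 ∷ 12 ∷ 8 ∷ 4 ∷ 1 ∷ 2 ∷ 5 ∷ 9 ∷ 13 ∷ 15 ∷ 17 ∷ 16 ∷ 14 ∷ 11 ∷ 7 ∷ []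
seed-path 4 5 7 = 0 ∷ 4 ∷ 7 ∷ 9 ∷ 13 ∷ 17 ∷ 14 ∷ 10 ∷ 11 ∷ 15 ∷ 18 ∷ 16 ∷ 12 ∷ 8 ∷ 6 ∷ 3 ∷ 1 ∷ 2 ∷ 5 ∷ []
seed-path 4 5 8 = 0 ∷ 3 ∷ 6 ∷ 10 ∷ 14 ∷ 12 ∷ 8 ∷ 4 ∷ 1 ∷ 2 ∷ 5 ∷ 9 ∷ 13 ∷ 16 ∷ 18 ∷ 19 ∷ 17 ∷ 15 ∷ 11 ∷ 7 ∷ []
seed-path 4 6 1 = 0 ∷ 4 ∷ 7 ∷ 10 ∷ 12 ∷ 13 ∷ 11 ∷ 9 ∷ 6 ∷ 3 ∷ 1 ∷ 2 ∷ 5 ∷ 8 ∷ []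
seed-path 4 6 2 = 0 ∷ 4 ∷ 7 ∷ 9 ∷ 12 ∷ 14 ∷ 11 ∷ 13 ∷ 10 ∷ 8 ∷ 5 ∷ 1 ∷ 2 ∷ 3 ∷ 6 ∷ []
seed-path 4 6 3 = 0 ∷ 3 ∷ 7 ∷ 10 ∷ 12 ∷ 14 ∷ 15 ∷ 13 ∷ 11 ∷ 8 ∷ 4 ∷ 1 ∷ 2 ∷ 5 ∷ 9 ∷ 6 ∷ []
seed-path 4 6 4 = 0 ∷ 3 ∷ 6 ∷ 8 ∷ 11 ∷ 15 ∷ 14 ∷ 10 ∷ 12 ∷ 16 ∷ 13 ∷ 9 ∷ 7 ∷ 5 ∷ 2 ∷ 1 ∷ 4 ∷ []
seed-path 4 6 5 = 0 ∷ 3 ∷ 6 ∷ 10 ∷ 13 ∷ 9 ∷ 7 ∷ 11 ∷ 15 ∷ 17 ∷ 16 ∷ 14 ∷ 12 ∷ 8 ∷ 5 ∷ 2 ∷ 1 ∷ 4 ∷ []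
seed-path 4 6 6 = 0 ∷ 4 ∷ 7 ∷ 9 ∷ 12 ∷ 16 ∷ 18 ∷ 15 ∷ 11 ∷ 13 ∷ 17 ∷ 14 ∷ 10 ∷ 8 ∷ 5 ∷ 1 ∷ 2 ∷ 3 ∷ 6 ∷ []
seed-path 4 6 7 = 0 ∷ 3 ∷ 7 ∷ 11 ∷ 13 ∷ 17 ∷ 19 ∷ 16 ∷ 15 ∷ 18 ∷ 14 ∷ 12 ∷ 9 ∷ 5 ∷ 2 ∷ 1 ∷ 4 ∷ 8 ∷ 10 ∷ 6 ∷ []
seed-path 4 6 8 = 0 ∷ 4 ∷ 7 ∷ 11 ∷ 15 ∷ 18 ∷ 20 ∷ 19 ∷ 17 ∷ 13 ∷ 9 ∷ 6 ∷ 3 ∷ 1 ∷ 2 ∷ 5 ∷ 8 ∷ 12 ∷ 16 ∷ 14 ∷ 10 ∷ []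
seed-path _ _ _ = []

seed? : ∀ b c d → Maybe (Growable (multiset1234 2 b c d) (Wanted b c d))
seed? b c d =
  Maybe.map assemble
    (zip (realization? L P) (zip (when? (2 <? b) (cut? n 2 P)) (zip (when? (3 <? c) (cut? n 3 P)) (when? (4 <? d) (cut? n 4 P)))))
  where
  L = multiset1234 2 b c d
  P = seed-path b c d
  n = suc (length L)
  assemble : IsLinearRealization L P × (2 < b → Cut n 2 P) × (3 < c → Cut n 3 P) × (4 < d → Cut n 4 P) →
    Growable L (Wanted b c d)
  assemble (r , cut₂ , cut₃ , cut₄) = record { path = P ; realizes = r ; cuts = λ {k} → select k cut₂ cut₃ cut₄ }

seeds-found : ∀ {b} → b < 4 → ∀ {c} → c < 6 → ∀ {d} → d < 8 → T (is-just (seed? (suc b) (suc c) (suc d)))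
seeds-found = from-yes (allUpTo? (λ b → allUpTo? (λ c → allUpTo? (λ d → T? (is-just (seed? (suc b) (suc c) (suc d)))) 8) 6) 4)

seed : ∀ {b c d} → b < 4 → c < 6 → d < 8 →
  Growable (multiset1234 2 (suc b) (suc c) (suc d)) (Wanted (suc b) (suc c) (suc d))
seed {b} {c} {d} b<4 c<6 d<8 = to-witness-T (seed? (suc b) (suc c) (suc d)) (seeds-found b<4 c<6 d<8)

-- Every x ≥ 1 is x₀ + m·k with x₀ = base + 1 ∈ [1, 2k], where m > 0 only if x₀ > k
-- (so that the seed x₀ has more than k copies of k whenever it is grown).
record Decomposition (k x : ℕ) : Set where
  field
    base  : ℕ
    steps : ℕ
    x≡    : x ≡ suc base + steps * k
    base< : base < 2 * k
    grown : steps ≡ 0 ⊎ k < suc base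

decompose : ∀ k x .{{_ : NonZero k}} → 1 ≤ x → Decomposition k x
decompose k (suc x) _ with suc x ≤? k
... | yes x<k = record
  { base = x ; steps = 0 ; x≡ = sym (+-identityʳ (suc x)) ; base< = ≤-trans x<k (m≤m+n k _) ; grown = inj₁ refl }
... | no x≮k = record
  { base  = k + y % k
  ; steps = y / k
  ; x≡    = cong suc (begin
      x                         ≡⟨ m+[n∸m]≡n (s≤s⁻¹ (≰⇒> x≮k)) ⟨
      k + y                     ≡⟨ cong (k +_) (m≡m%n+[m/n]*n y k) ⟩
      k + (y % k + y / k * k)   ≡⟨ +-assoc k (y % k) _ ⟨
      k + y % k + y / k * k     ∎)
  ; base< = +-monoʳ-< k (≤-trans (m%n<n y k) (m≤m+n k 0))
  ; grown = inj₂ (s≤s (m≤m+n k (y % k)))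
  }
  where
  open ≡-Reasoning
  y = x ∸ k

multiset-grow : ∀ a b c d i j l →
  replicate i 2 ++ replicate j 3 ++ replicate l 4 ++ multiset1234 a b c d ↭ multiset1234 a (b + i) (c + j) (d + l)
multiset-grow a b c d i j l
  rewrite replicate-+ b i 2 | replicate-+ c j 3 | replicate-+ d l 4 =
  prove 7 (I ⊕ (J ⊕ (K ⊕ (A ⊕ (B ⊕ (C ⊕ D)))))) (A ⊕ ((B ⊕ I) ⊕ ((C ⊕ J) ⊕ (D ⊕ K))))
    (replicate a 1 ∷ replicate b 2 ∷ replicate c 3 ∷ replicate d 4 ∷ replicate i 2 ∷ replicate j 3 ∷ replicate l 4 ∷ [])
  where
  open import Algebra.Solver.CommutativeMonoid (++-commutativeMonoid {A = ℕ})
  open import Data.Vec using ([]; _∷_)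
  A = var (# 0)
  B = var (# 1)
  C = var (# 2)
  D = var (# 3)
  I = var (# 4)
  J = var (# 5)
  K = var (# 6)

proposition5p7 : (c d : ℕ) → c ≥ 1 → d ≥ 1 → (b : ℕ) → b ≥ 1 →
    HasLinearRealization (multiset1234 2 b c d)
proposition5p7 c d 1≤c 1≤d b 1≤b = path final , realizes final
  where
  open Decomposition
  B = decompose 2 b 1≤b
  C = decompose 3 c 1≤c
  D = decompose 4 d 1≤d
  seeded = seed (base< B) (base< C) (base< D)
  counts : multiset1234 2 (suc (base B) + steps B * 2) (suc (base C) + steps C * 3) (suc (base D) + steps D * 4)
         ≡ multiset1234 2 b c d
  counts = trans (cong₂ (λ x y → multiset1234 2 x y (suc (base D) + steps D * 4)) (sym (x≡ B)) (sym (x≡ C))) (cong (multiset1234 2 b c) (sym (x≡ D)))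
  final : Growable (multiset1234 2 b c d) _
  final = growable-↭ (↭-trans (multiset-grow 2 (suc (base B)) (suc (base C)) (suc (base D)) _ _ _) (↭-reflexive counts))
            (grow-by 2 (steps B) (grown B) (grow-by 3 (steps C) (grown C) (grow-by 4 (steps D) (grown D) seeded)))
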